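{- Let $m,n$ be integers with $1\le m\le n$, $2\le n\le 2m+1$ and $m\neq n$. Then the metric dimension of the Villarceau grid Type I satisfies $\dim(VG^1_{m,n})\le 3$.
   Context: For a connected graph $G$ and an ordered set $R=\{r_1,\dots,r_l\}\subseteq V(G)$, the code of a vertex $s$ is $(d(s,r_1),\dots,d(s,r_l))$, where $d$ is the shortest-path distance. $R$ is a resolving set if distinct vertices have distinct codes; $\dim(G)$ is the minimum cardinality of a resolving set. For integers $1\le m\le n$, the Villarceau grid Type I $VG^1_{m,n}$ is the graph with vertex set $\{(2i,2j+1): i\in\{0,\dots,n\},\ j\in\{0,\dots,m-1\}\}\cup\{(2i+1,2j): i\in\{0,\dots,n-1\},\ j\in\{0,\dots,m\}\}$, in which $(i_1,j_1)$ and $(i_2,j_2)$ are adjacent if and only if $|i_1-i_2|=1$ and $|j_1-j_2|=1$. -}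

module Defs where

open import Data.Nat using (ℕ; suc; _+_; _*_; _∸_; _≤_; _<_; ∣_-_∣)
open import Data.Product using (_×_; _,_; Σ; ∃; ∃-syntax)
open import Data.Sum using (_⊎_)
open import Data.List using (List; length)
open import Data.List.Membership.Propositional using (_∈_)
open import Data.List.Relation.Unary.All using (All)
open import Relation.Binary.PropositionalEquality using (_≡_)

Pt : Set
Pt = ℕ × ℕ

IsVertex : ℕ → ℕ → Pt → Set
IsVertex m n (x , y) =
  (∃[ i ] ∃[ j ] (i ≤ n × j < m × x ≡ 2 * i × y ≡ 2 * j + 1))
  ⊎ (∃[ i ] ∃[ j ] (i < n × j ≤ m × x ≡ 2 * i + 1 × y ≡ 2 * j))

Adj : ℕ → ℕ → Pt → Pt → Set
Adj m n (x₁ , y₁) (x₂ , y₂) =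
  IsVertex m n (x₁ , y₁) × IsVertex m n (x₂ , y₂) ×
  ∣ x₁ - x₂ ∣ ≡ 1 × ∣ y₁ - y₂ ∣ ≡ 1

data Walk (m n : ℕ) : Pt → Pt → ℕ → Set where
  here : ∀ {u} → IsVertex m n u → Walk m n u u 0
  step : ∀ {u w v k} → Adj m n u w → Walk m n w v k → Walk m n u v (suc k)

Dist : ℕ → ℕ → Pt → Pt → ℕ → Set
Dist m n u v d = Walk m n u v d × (∀ k → Walk m n u v k → d ≤ k)

SameCode : ℕ → ℕ → List Pt → Pt → Pt → Set
SameCode m n R s t = ∀ r → r ∈ R → ∃[ d ] (Dist m n s r d × Dist m n t r d)

Resolving : ℕ → ℕ → List Pt → Set
Resolving m n R =
  All (IsVertex m n) R ×
  (∀ s t → IsVertex m n s → IsVertex m n t → SameCode m n R s t → s ≡ t)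

DimAtMost : ℕ → ℕ → ℕ → Set
DimAtMost m n k = ∃[ R ] (Resolving m n R × length R ≤ k)

{-# OPTIONS --safe #-}
module Submission where

-- The vertices of VG¹_{m,n} are the points of [0,2n] × [0,2m] with x + y odd, and the graph
-- distance is the Chebyshev distance max(|Δx|, |Δy|): both coordinates move at every step, and
-- the one with less to travel uses up its surplus, which is even, by bouncing back and forth.
-- In the rotated coordinates P = x + y, Q = x + 2m − y this is half the taxicab distance
-- |ΔP| + |ΔQ|.  For the landmarks (1, 0), (2n − 1, 0), (2m + 1, 2m) the codes at the first and
-- the third share the Q-term, so comparing them determines P unless P ≥ 4m + 1 for both vertices.
-- In that region the codes at the first two landmarks are, up to constants, P + Q and P − Q.

open import Defs
open import Data.Nat using (ℕ; _≤_; _*_; _+_)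
open import Relation.Binary.PropositionalEquality using (_≢_)

open import Data.List using (List; []; _∷_)
open import Data.List.Membership.Propositional using (_∈_)
open import Data.List.Relation.Unary.All as All using (All; []; _∷_)
open import Data.List.Relation.Unary.Any using (here; there)
open import Data.Nat using (zero; suc; _∸_; _⊔_; ∣_-_∣; _<_; z≤n; s≤s; parity; ⌊_/2⌋)
open import Data.Nat.Properties
open import Algebra.Properties.CommutativeSemigroup +-commutativeSemigroup
  using (interchange; xy∙z≈xz∙y)
open import Data.Nat.Tactic.RingSolver using (solve-∀)
open import Data.Parity.Base as ℙ using (0ℙ; 1ℙ; _⁻¹)
open import Data.Parity.Properties using (⁻¹-involutive; suc-homo-⁻¹; +-homo-+; *-homo-*)
open import Data.Product as Product using (_×_; _,_; proj₁; proj₂; ∃-syntax)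
open import Data.Sum as Sum using (_⊎_; inj₁; inj₂)
open import Relation.Nullary using (contradiction)
open import Relation.Binary.PropositionalEquality
  using (_≡_; refl; sym; trans; cong; cong₂; subst; subst₂; module ≡-Reasoning)

parity-even : ∀ i → parity (2 * i) ≡ 0ℙ
parity-even i = *-homo-* 2 i

parity-odd : ∀ i → parity (2 * i + 1) ≡ 1ℙ
parity-odd i = trans (+-homo-+ (2 * i) 1) (cong (ℙ._+ 1ℙ) (parity-even i))

parity≡0ℙ⇒even : ∀ a → parity a ≡ 0ℙ → a ≡ 2 * ⌊ a /2⌋
parity≡0ℙ⇒even zero          _ = refl
parity≡0ℙ⇒even (suc (suc a)) p =
  trans (cong (2 +_) (parity≡0ℙ⇒even a p)) (sym (*-suc 2 ⌊ a /2⌋))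

parity≡1ℙ⇒odd : ∀ a → parity a ≡ 1ℙ → a ≡ 2 * ⌊ a /2⌋ + 1
parity≡1ℙ⇒odd (suc zero)    _ = refl
parity≡1ℙ⇒odd (suc (suc a)) p =
  trans (cong (2 +_) (parity≡1ℙ⇒odd a p)) (sym (cong (_+ 1) (*-suc 2 ⌊ a /2⌋)))

parity-suc : ∀ a → parity (suc a) ≡ parity a ⁻¹
parity-suc a = trans (sym (⁻¹-involutive _)) (cong _⁻¹ (suc-homo-⁻¹ a))

p⁻¹+q⁻¹≡p+q : ∀ p q → p ⁻¹ ℙ.+ q ⁻¹ ≡ p ℙ.+ q
p⁻¹+q⁻¹≡p+q 0ℙ q = ⁻¹-involutive q
p⁻¹+q⁻¹≡p+q 1ℙ q = refl

parity-∣-∣ : ∀ a b → parity ∣ a - b ∣ ≡ parity a ℙ.+ parity b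
parity-∣-∣ zero    zero    = refl
parity-∣-∣ zero    (suc b) = refl
parity-∣-∣ (suc a) zero    = sym (Data.Parity.Properties.+-identityʳ _)
parity-∣-∣ (suc a) (suc b) = begin
  parity ∣ a - b ∣                         ≡⟨ parity-∣-∣ a b ⟩
  parity a ℙ.+ parity b                    ≡⟨ cong₂ ℙ._+_ (suc-homo-⁻¹ a) (suc-homo-⁻¹ b) ⟨
  parity (suc a) ⁻¹ ℙ.+ parity (suc b) ⁻¹  ≡⟨ p⁻¹+q⁻¹≡p+q (parity (suc a)) (parity (suc b)) ⟩
  parity (suc a) ℙ.+ parity (suc b)        ∎
  where open ≡-Reasoning

parity-⊔ : ∀ a b → parity a ≡ parity b → parity (a ⊔ b) ≡ parity a
parity-⊔ a b same with ⊔-sel a b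
... | inj₁ a⊔b≡a = cong parity a⊔b≡a
... | inj₂ a⊔b≡b = trans (cong parity a⊔b≡b) (sym same)

≤∧parity≡⇒even-gap : ∀ {a b} → a ≤ b → parity a ≡ parity b → ∃[ t ] b ≡ 2 * t + a
≤∧parity≡⇒even-gap {b = b} z≤n same =
  ⌊ b /2⌋ , trans (parity≡0ℙ⇒even b (sym same)) (sym (+-identityʳ _))
≤∧parity≡⇒even-gap {suc a} {suc b} (s≤s a≤b) same =
  Product.map₂ (λ e → trans (cong suc e) (sym (+-suc _ a))) (≤∧parity≡⇒even-gap a≤b same′)
  where
    same′ : parity a ≡ parity b
    same′ = trans (sym (suc-homo-⁻¹ a)) (trans (cong _⁻¹ same) (suc-homo-⁻¹ b))

InGrid : ℕ → ℕ → Pt → Set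
InGrid m n (x , y) = x ≤ 2 * n × y ≤ 2 * m × parity y ≡ parity x ⁻¹

j<m⇒2j+1≤2m : ∀ {j m} → j < m → 2 * j + 1 ≤ 2 * m
j<m⇒2j+1≤2m {j} {m} j<m = subst (_≤ 2 * m) (+-comm 1 (2 * j)) (*-monoʳ-< 2 j<m)

2j+1≤2m⇒j<m : ∀ {j m} → 2 * j + 1 ≤ 2 * m → j < m
2j+1≤2m⇒j<m {j} {m} le = *-cancelˡ-< 2 j m (subst (_≤ 2 * m) (+-comm (2 * j) 1) le)

isVertex⇒inGrid : ∀ {m n p} → IsVertex m n p → InGrid m n p
isVertex⇒inGrid (inj₁ (i , j , i≤n , j<m , refl , refl)) =
  *-monoʳ-≤ 2 i≤n , j<m⇒2j+1≤2m j<m , trans (parity-odd j) (cong _⁻¹ (sym (parity-even i)))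
isVertex⇒inGrid (inj₂ (i , j , i<n , j≤m , refl , refl)) =
  j<m⇒2j+1≤2m i<n , *-monoʳ-≤ 2 j≤m , trans (parity-even j) (cong _⁻¹ (sym (parity-odd i)))

inGrid⇒isVertex : ∀ {m n x y} → InGrid m n (x , y) → IsVertex m n (x , y)
inGrid⇒isVertex {m} {n} {x} {y} (x≤2n , y≤2m , opposite) with parity x in px
... | 0ℙ = inj₁ (⌊ x /2⌋ , ⌊ y /2⌋ , *-cancelˡ-≤ 2 (subst (_≤ 2 * n) x-even x≤2n) ,
                 2j+1≤2m⇒j<m (subst (_≤ 2 * m) y-odd y≤2m) , x-even , y-odd)
  where
    x-even : x ≡ 2 * ⌊ x /2⌋
    x-even = parity≡0ℙ⇒even x px
    y-odd : y ≡ 2 * ⌊ y /2⌋ + 1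
    y-odd = parity≡1ℙ⇒odd y opposite
... | 1ℙ = inj₂ (⌊ x /2⌋ , ⌊ y /2⌋ , 2j+1≤2m⇒j<m (subst (_≤ 2 * n) x-odd x≤2n) ,
                 *-cancelˡ-≤ 2 (subst (_≤ 2 * m) y-even y≤2m) , x-odd , y-even)
  where
    x-odd : x ≡ 2 * ⌊ x /2⌋ + 1
    x-odd = parity≡1ℙ⇒odd x px
    y-even : y ≡ 2 * ⌊ y /2⌋
    y-even = parity≡0ℙ⇒even y opposite

inGrid⇒0<x+y : ∀ {m n x y} → InGrid m n (x , y) → 0 < x + y
inGrid⇒0<x+y {x = suc _}        _            = s≤s z≤n
inGrid⇒0<x+y {x = zero} {suc y} _            = s≤s z≤n
inGrid⇒0<x+y {x = zero} {zero}  (_ , _ , ())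

data Step : ℕ → ℕ → Set where
  inc : ∀ {a} → Step a (suc a)
  dec : ∀ {a} → Step (suc a) a

step-∣-∣ : ∀ {a b} → Step a b → ∣ a - b ∣ ≡ 1
step-∣-∣ {a}     inc = subst (λ b → ∣ a - b ∣ ≡ 1) (+-comm a 1) (∣m-m+n∣≡n a 1)
step-∣-∣ {suc a} dec = trans (∣-∣-comm (suc a) a) (step-∣-∣ {a} inc)

step-parity : ∀ {a b} → Step a b → parity b ≡ parity a ⁻¹
step-parity {a}     inc = parity-suc a
step-parity {b = b} dec = sym (suc-homo-⁻¹ b)

steps-preserve-opposite-parity : ∀ {x y x′ y′} → Step x x′ → Step y y′ →
  parity y ≡ parity x ⁻¹ → parity y′ ≡ parity x′ ⁻¹
steps-preserve-opposite-parity sx sy opposite =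
  trans (step-parity sy) (cong _⁻¹ (trans opposite (sym (step-parity sx))))

-- Only the points reached by a step are required to lie in [0, N], not the starting point.
data Path (N : ℕ) : ℕ → ℕ → ℕ → Set where
  []   : ∀ {a} → Path N a a 0
  move : ∀ {a b c k} → Step a b → b ≤ N → Path N b c k → Path N a c (suc k)

shift : ∀ {N a b k} → Path N a b k → Path (suc N) (suc a) (suc b) k
shift []               = []
shift (move inc b≤N p) = move inc (s≤s b≤N) (shift p)
shift (move dec b≤N p) = move dec (s≤s b≤N) (shift p)

straight : ∀ {N a b} → a ≤ N → b ≤ N → Path N a b ∣ a - b ∣
straight {a = zero}        {zero}  _         _         = []
straight {a = zero}        {suc b} _         (s≤s b≤N) = move inc (s≤s z≤n) (shift (straight z≤n b≤N))
straight {a = suc zero}    {zero}  _         _         = move dec z≤n []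
straight {a = suc (suc a)} {zero}  a<N       _         = move dec (<⇒≤ a<N) (straight (<⇒≤ a<N) z≤n)
straight {a = suc a}       {suc b} (s≤s a≤N) (s≤s b≤N) = shift (straight a≤N b≤N)

bounce : ∀ {N a b k} → 1 ≤ N → a ≤ N → Path N a b k → Path N a b (2 + k)
bounce {a = zero}  1≤N _   p = move inc 1≤N (move dec z≤n p)
bounce {a = suc a} _   a<N p = move dec (<⇒≤ a<N) (move inc a<N p)

pad : ∀ {N a b k} t → 1 ≤ N → a ≤ N → Path N a b k → Path N a b (2 * t + k)
pad zero _ _ p = p
pad {N} {a} {b} {k} (suc t) 1≤N a≤N p =
  subst (Path N a b) (cong (_+ k) (sym (*-suc 2 t))) (bounce 1≤N a≤N (pad t 1≤N a≤N p))

path-of-length : ∀ {N a b k} → 1 ≤ N → a ≤ N → b ≤ N →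
  ∣ a - b ∣ ≤ k → parity ∣ a - b ∣ ≡ parity k → Path N a b k
path-of-length 1≤N a≤N b≤N d≤k same with ≤∧parity≡⇒even-gap d≤k same
... | t , refl = pad t 1≤N a≤N (straight a≤N b≤N)

zip-paths : ∀ {m n x y x′ y′ k} → InGrid m n (x , y) →
  Path (2 * n) x x′ k → Path (2 * m) y y′ k → Walk m n (x , y) (x′ , y′) k
zip-paths g [] [] = here (inGrid⇒isVertex g)
zip-paths {m} {n} g@(_ , _ , opposite) (move {b = x₁} sx x₁≤2n px) (move {b = y₁} sy y₁≤2m py) =
  step (inGrid⇒isVertex g , inGrid⇒isVertex g₁ , step-∣-∣ sx , step-∣-∣ sy) (zip-paths g₁ px py)
  where
    g₁ : InGrid m n (x₁ , y₁)
    g₁ = x₁≤2n , y₁≤2m , steps-preserve-opposite-parity sx sy opposite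

cheb : Pt → Pt → ℕ
cheb (x , y) (x′ , y′) = ∣ x - x′ ∣ ⊔ ∣ y - y′ ∣

cheb-triangle : ∀ u v w → cheb u w ≤ cheb u v + cheb v w
cheb-triangle (x , y) (x′ , y′) (x″ , y″) = ⊔-lub
  (≤-trans (∣-∣-triangle x x′ x″) (+-mono-≤ (m≤m⊔n ∣ x - x′ ∣ _) (m≤m⊔n ∣ x′ - x″ ∣ _)))
  (≤-trans (∣-∣-triangle y y′ y″) (+-mono-≤ (m≤n⊔m ∣ x - x′ ∣ _) (m≤n⊔m ∣ x′ - x″ ∣ _)))

walk⇒cheb≤ : ∀ {m n u v k} → Walk m n u v k → cheb u v ≤ k
walk⇒cheb≤ {u = x , y} (here _) = ≤-reflexive (cong₂ _⊔_ (∣n-n∣≡0 x) (∣n-n∣≡0 y))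
walk⇒cheb≤ {u = u@(_ , _)} {v} (step {w = w@(_ , _)} {k = k} (_ , _ , ∣Δx∣≡1 , ∣Δy∣≡1) rest) =
  begin
    cheb u v             ≤⟨ cheb-triangle u w v ⟩
    cheb u w + cheb w v  ≡⟨ cong (_+ cheb w v) (cong₂ _⊔_ ∣Δx∣≡1 ∣Δy∣≡1) ⟩
    1 + cheb w v         ≤⟨ s≤s (walk⇒cheb≤ rest) ⟩
    suc k                ∎
  where open ≤-Reasoning

opposite-parity⇒∣-∣-parity : ∀ x y x′ y′ → parity y ≡ parity x ⁻¹ → parity y′ ≡ parity x′ ⁻¹ →
  parity ∣ x - x′ ∣ ≡ parity ∣ y - y′ ∣
opposite-parity⇒∣-∣-parity x y x′ y′ opposite opposite′ = begin
  parity ∣ x - x′ ∣             ≡⟨ parity-∣-∣ x x′ ⟩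
  parity x ℙ.+ parity x′        ≡⟨ p⁻¹+q⁻¹≡p+q (parity x) (parity x′) ⟨
  parity x ⁻¹ ℙ.+ parity x′ ⁻¹  ≡⟨ cong₂ ℙ._+_ opposite opposite′ ⟨
  parity y ℙ.+ parity y′        ≡⟨ parity-∣-∣ y y′ ⟨
  parity ∣ y - y′ ∣             ∎
  where open ≡-Reasoning

cheb-walk : ∀ {m n u v} → 1 ≤ m → 1 ≤ n → InGrid m n u → InGrid m n v → Walk m n u v (cheb u v)
cheb-walk {m} {n} {x , y} {x′ , y′} 1≤m 1≤n g@(x≤2n , y≤2m , opposite) (x′≤2n , y′≤2m , opposite′) =
  zip-paths g
    (path-of-length (≤-trans 1≤n (m≤m+n n _)) x≤2n x′≤2n (m≤m⊔n _ _) (sym (parity-⊔ Δx Δy same)))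
    (path-of-length (≤-trans 1≤m (m≤m+n m _)) y≤2m y′≤2m (m≤n⊔m _ _)
      (sym (trans (parity-⊔ Δx Δy same) same)))
  where
    Δx Δy : ℕ
    Δx = ∣ x - x′ ∣
    Δy = ∣ y - y′ ∣
    same : parity Δx ≡ parity Δy
    same = opposite-parity⇒∣-∣-parity x y x′ y′ opposite opposite′

dist≡cheb : ∀ {m n u v d} → 1 ≤ m → 1 ≤ n → InGrid m n u → InGrid m n v →
  Dist m n u v d → d ≡ cheb u v
dist≡cheb 1≤m 1≤n gu gv (walk , shortest) =
  ≤-antisym (shortest _ (cheb-walk 1≤m 1≤n gu gv)) (walk⇒cheb≤ walk)

rotate : ℕ → Pt → Pt
rotate c (x , y) = x + y , x + (c ∸ y)

taxicab : Pt → Pt → ℕ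
taxicab (p , q) (p′ , q′) = ∣ p - p′ ∣ + ∣ q - q′ ∣

2*[m⊔n]≡m+n+∣m-n∣ : ∀ m n → 2 * (m ⊔ n) ≡ m + n + ∣ m - n ∣
2*[m⊔n]≡m+n+∣m-n∣ zero    n       = cong (n +_) (+-identityʳ n)
2*[m⊔n]≡m+n+∣m-n∣ (suc m) zero    = cong₂ _+_ (sym (+-identityʳ (suc m))) (+-identityʳ (suc m))
2*[m⊔n]≡m+n+∣m-n∣ (suc m) (suc n) = begin
  2 * suc (m ⊔ n)            ≡⟨ *-suc 2 (m ⊔ n) ⟩
  2 + 2 * (m ⊔ n)            ≡⟨ cong (2 +_) (2*[m⊔n]≡m+n+∣m-n∣ m n) ⟩
  2 + (m + n + ∣ m - n ∣)    ≡⟨ cong (λ k → suc (k + ∣ m - n ∣)) (+-suc m n) ⟨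
  suc m + suc n + ∣ m - n ∣  ∎
  where open ≡-Reasoning

∣m+o-n+o∣≡∣m-n∣ : ∀ m n o → ∣ m + o - (n + o) ∣ ≡ ∣ m - n ∣
∣m+o-n+o∣≡∣m-n∣ m n o = trans (cong₂ ∣_-_∣ (+-comm m o) (+-comm n o)) (∣m+n-m+o∣≡∣n-o∣ o m n)

2*⊔≡rotated-taxicab₀ : ∀ x y y′ {z z′} → y + z ≡ y′ + z′ →
  2 * (x ⊔ ∣ y - y′ ∣) ≡ ∣ x + y - y′ ∣ + ∣ x + z - z′ ∣
2*⊔≡rotated-taxicab₀ x (suc y) (suc y′) e rewrite +-suc x y =
  2*⊔≡rotated-taxicab₀ x y y′ (suc-injective e)
2*⊔≡rotated-taxicab₀ x y zero {z} refl = begin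
  2 * (x ⊔ ∣ y - 0 ∣)                  ≡⟨ cong (λ d → 2 * (x ⊔ d)) (∣-∣-identityʳ y) ⟩
  2 * (x ⊔ y)                          ≡⟨ 2*[m⊔n]≡m+n+∣m-n∣ x y ⟩
  x + y + ∣ x - y ∣                    ≡⟨ cong₂ _+_ (∣-∣-identityʳ (x + y)) (∣m+o-n+o∣≡∣m-n∣ x y z) ⟨
  ∣ x + y - 0 ∣ + ∣ x + z - (y + z) ∣  ∎
  where open ≡-Reasoning
2*⊔≡rotated-taxicab₀ x zero (suc y′) {z′ = z′} refl = begin
  2 * (x ⊔ suc y′)                                ≡⟨ 2*[m⊔n]≡m+n+∣m-n∣ x (suc y′) ⟩
  x + suc y′ + ∣ x - suc y′ ∣                     ≡⟨ +-comm (x + suc y′) _ ⟩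
  ∣ x - suc y′ ∣ + (x + suc y′)                   ≡⟨ cong₂ _+_ (cong (∣_- suc y′ ∣) (+-identityʳ x))
                                                              z-term ⟨
  ∣ x + 0 - suc y′ ∣ + ∣ x + (suc y′ + z′) - z′ ∣  ∎
  where
    open ≡-Reasoning
    z-term : ∣ x + (suc y′ + z′) - z′ ∣ ≡ x + suc y′
    z-term = begin
      ∣ x + (suc y′ + z′) - z′ ∣  ≡⟨ cong (∣_- z′ ∣) (+-assoc x (suc y′) z′) ⟨
      ∣ x + suc y′ + z′ - z′ ∣    ≡⟨ ∣m+o-n+o∣≡∣m-n∣ (x + suc y′) 0 z′ ⟩
      ∣ x + suc y′ - 0 ∣          ≡⟨ ∣-∣-identityʳ (x + suc y′) ⟩
      x + suc y′                  ∎

2*⊔≡rotated-taxicab : ∀ x x′ {y y′ z z′} → y + z ≡ y′ + z′ →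
  2 * (∣ x - x′ ∣ ⊔ ∣ y - y′ ∣) ≡ ∣ x + y - (x′ + y′) ∣ + ∣ x + z - (x′ + z′) ∣
2*⊔≡rotated-taxicab (suc x) (suc x′) e = 2*⊔≡rotated-taxicab x x′ e
2*⊔≡rotated-taxicab zero    zero     {y} {y′} e = 2*⊔≡rotated-taxicab₀ 0 y y′ e
2*⊔≡rotated-taxicab (suc x) zero     {y} {y′} e = 2*⊔≡rotated-taxicab₀ (suc x) y y′ e
2*⊔≡rotated-taxicab zero    (suc x′) {y} {y′} {z} {z′} e = begin
  2 * (suc x′ ⊔ ∣ y - y′ ∣)                  ≡⟨ cong (λ d → 2 * (suc x′ ⊔ d)) (∣-∣-comm y y′) ⟩
  2 * (suc x′ ⊔ ∣ y′ - y ∣)                  ≡⟨ 2*⊔≡rotated-taxicab₀ (suc x′) y′ y (sym e) ⟩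
  ∣ suc x′ + y′ - y ∣ + ∣ suc x′ + z′ - z ∣  ≡⟨ cong₂ _+_ (∣-∣-comm _ y) (∣-∣-comm _ z) ⟩
  ∣ y - suc x′ + y′ ∣ + ∣ z - suc x′ + z′ ∣  ∎
  where open ≡-Reasoning

2*cheb≡taxicab∘rotate : ∀ c {x y x′ y′} → y ≤ c → y′ ≤ c →
  2 * cheb (x , y) (x′ , y′) ≡ taxicab (rotate c (x , y)) (rotate c (x′ , y′))
2*cheb≡taxicab∘rotate c {x} {x′ = x′} y≤c y′≤c =
  2*⊔≡rotated-taxicab x x′ (trans (m+[n∸m]≡n y≤c) (sym (m+[n∸m]≡n y′≤c)))

m+n≡m′+n′⇒m+o≡m′+o′⇒n+o≡n′+o′⇒m≡m′ : ∀ {m n o m′ n′ o′} →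
  m + n ≡ m′ + n′ → m + o ≡ m′ + o′ → n + o ≡ n′ + o′ → m ≡ m′
m+n≡m′+n′⇒m+o≡m′+o′⇒n+o≡n′+o′⇒m≡m′ {m} {n} {o} {m′} {n′} {o′} e₁ e₂ e₃ =
  *-cancelˡ-≡ m m′ 2 (+-cancelʳ-≡ (n + o) (2 * m) (2 * m′) (begin
    2 * m + (n + o)        ≡⟨ regroup m n o ⟩
    (m + n) + (m + o)      ≡⟨ cong₂ _+_ e₁ e₂ ⟩
    (m′ + n′) + (m′ + o′)  ≡⟨ regroup m′ n′ o′ ⟨
    2 * m′ + (n′ + o′)     ≡⟨ cong (2 * m′ +_) e₃ ⟨
    2 * m′ + (n + o)       ∎))
  where
    open ≡-Reasoning
    regroup : ∀ a b c → 2 * a + (b + c) ≡ (a + b) + (a + c)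
    regroup = solve-∀

m+n≡m′+n′⇒o+n≡o′+n′⇒m+o′≡m′+o : ∀ m n o m′ n′ o′ →
  m + n ≡ m′ + n′ → o + n ≡ o′ + n′ → m + o′ ≡ m′ + o
m+n≡m′+n′⇒o+n≡o′+n′⇒m+o′≡m′+o m n o m′ n′ o′ e₁ e₂ =
  +-cancelʳ-≡ (n + n′) (m + o′) (m′ + o) (begin
    (m + o′) + (n + n′)  ≡⟨ interchange m o′ n n′ ⟩
    (m + n) + (o′ + n′)  ≡⟨ cong₂ _+_ e₁ (sym e₂) ⟩
    (m′ + n′) + (o + n)  ≡⟨ interchange m′ n′ o n ⟩
    (m′ + o) + (n′ + n)  ≡⟨ cong ((m′ + o) +_) (+-comm n′ n) ⟩
    (m′ + o) + (n + n′)  ∎)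
  where open ≡-Reasoning

rotate-injective : ∀ c {x y x′ y′} → y ≤ c → y′ ≤ c →
  rotate c (x , y) ≡ rotate c (x′ , y′) → (x , y) ≡ (x′ , y′)
rotate-injective c {x} {y} {x′} {y′} y≤c y′≤c e = cong₂ _,_ x≡x′ (+-cancelˡ-≡ x′ y y′ sum≡)
  where
    x≡x′ : x ≡ x′
    x≡x′ = m+n≡m′+n′⇒m+o≡m′+o′⇒n+o≡n′+o′⇒m≡m′ (cong proj₁ e) (cong proj₂ e)
      (trans (m+[n∸m]≡n y≤c) (sym (m+[n∸m]≡n y′≤c)))
    sum≡ : x′ + y ≡ x′ + y′
    sum≡ = trans (cong (_+ y) (sym x≡x′)) (cong proj₁ e)

∣m-n∣<1+m+1+n : ∀ m n → ∣ m - n ∣ < suc m + suc n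
∣m-n∣<1+m+1+n m n =
  s≤s (≤-trans (∣m-n∣≤m⊔n m n) (≤-trans (m⊔n≤m+n m n) (+-monoʳ-≤ m (n≤1+n n))))

-- p ↦ ∣p − a∣ − ∣p − k∣ increases strictly up to k and is constant from k on.
m+∣n-k∣≡n+∣m-k∣⇒m≡n⊎k≤m×k≤n : ∀ {m n k} → m + ∣ n - k ∣ ≡ n + ∣ m - k ∣ → m ≡ n ⊎ (k ≤ m × k ≤ n)
m+∣n-k∣≡n+∣m-k∣⇒m≡n⊎k≤m×k≤n {k = zero} _ = inj₂ (z≤n , z≤n)
m+∣n-k∣≡n+∣m-k∣⇒m≡n⊎k≤m×k≤n {zero}  {zero}  {suc k} _ = inj₁ refl
m+∣n-k∣≡n+∣m-k∣⇒m≡n⊎k≤m×k≤n {suc m} {suc n} {suc k} e =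
  Sum.map (cong suc) (Product.map s≤s s≤s) (m+∣n-k∣≡n+∣m-k∣⇒m≡n⊎k≤m×k≤n (suc-injective e))
m+∣n-k∣≡n+∣m-k∣⇒m≡n⊎k≤m×k≤n {zero}  {suc n} {suc k} e = contradiction e (<⇒≢ (∣m-n∣<1+m+1+n n k))
m+∣n-k∣≡n+∣m-k∣⇒m≡n⊎k≤m×k≤n {suc m} {zero}  {suc k} e = contradiction (sym e) (<⇒≢ (∣m-n∣<1+m+1+n m k))

∣m-a∣+∣n-k∣≡∣n-a∣+∣m-k∣⇒m≡n⊎k≤m×k≤n : ∀ {a m n k} → a ≤ m → a ≤ n →
  ∣ m - a ∣ + ∣ n - k ∣ ≡ ∣ n - a ∣ + ∣ m - k ∣ → m ≡ n ⊎ (k ≤ m × k ≤ n)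
∣m-a∣+∣n-k∣≡∣n-a∣+∣m-k∣⇒m≡n⊎k≤m×k≤n {k = zero} _ _ _ = inj₂ (z≤n , z≤n)
∣m-a∣+∣n-k∣≡∣n-a∣+∣m-k∣⇒m≡n⊎k≤m×k≤n {m = m} {n} {k} z≤n z≤n e =
  m+∣n-k∣≡n+∣m-k∣⇒m≡n⊎k≤m×k≤n
    (subst₂ (λ u v → u + ∣ n - k ∣ ≡ v + ∣ m - k ∣) (∣-∣-identityʳ m) (∣-∣-identityʳ n) e)
∣m-a∣+∣n-k∣≡∣n-a∣+∣m-k∣⇒m≡n⊎k≤m×k≤n {k = suc k} (s≤s a≤m) (s≤s a≤n) e =
  Sum.map (cong suc) (Product.map s≤s s≤s) (∣m-a∣+∣n-k∣≡∣n-a∣+∣m-k∣⇒m≡n⊎k≤m×k≤n a≤m a≤n e)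

taxicab-≥ : ∀ {p q a₁ a₂} → a₁ ≤ p → a₂ ≤ q → taxicab (p , q) (a₁ , a₂) + (a₁ + a₂) ≡ p + q
taxicab-≥ {p} {q} {a₁} {a₂} a₁≤p a₂≤q = begin
  ∣ p - a₁ ∣ + ∣ q - a₂ ∣ + (a₁ + a₂)  ≡⟨ cong₂ (λ u v → u + v + (a₁ + a₂))
                                            (m≤n⇒∣n-m∣≡n∸m a₁≤p) (m≤n⇒∣n-m∣≡n∸m a₂≤q) ⟩
  (p ∸ a₁) + (q ∸ a₂) + (a₁ + a₂)      ≡⟨ interchange (p ∸ a₁) (q ∸ a₂) a₁ a₂ ⟩
  (p ∸ a₁ + a₁) + (q ∸ a₂ + a₂)        ≡⟨ cong₂ _+_ (m∸n+n≡m a₁≤p) (m∸n+n≡m a₂≤q) ⟩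
  p + q                                ∎
  where open ≡-Reasoning

taxicab-≥≤ : ∀ {p q b₁ b₂} → b₁ ≤ p → q ≤ b₂ → taxicab (p , q) (b₁ , b₂) + b₁ ≡ p + (b₂ ∸ q)
taxicab-≥≤ {p} {q} {b₁} {b₂} b₁≤p q≤b₂ = begin
  ∣ p - b₁ ∣ + ∣ q - b₂ ∣ + b₁  ≡⟨ cong₂ (λ u v → u + v + b₁)
                                    (m≤n⇒∣n-m∣≡n∸m b₁≤p) (m≤n⇒∣m-n∣≡n∸m q≤b₂) ⟩
  (p ∸ b₁) + (b₂ ∸ q) + b₁      ≡⟨ xy∙z≈xz∙y (p ∸ b₁) (b₂ ∸ q) b₁ ⟩
  (p ∸ b₁) + b₁ + (b₂ ∸ q)      ≡⟨ cong (_+ (b₂ ∸ q)) (m∸n+n≡m b₁≤p) ⟩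
  p + (b₂ ∸ q)                  ∎
  where open ≡-Reasoning

module ThreeLandmarks (a₁ a₂ b₁ b₂ c₁ : ℕ) where

  Admissible : Pt → Set
  Admissible (p , q) = a₁ ≤ p × q ≤ b₂ × (c₁ ≤ p → a₂ ≤ q)

  codes-at-a,c⇒p≡p′⊎c₁≤p,p′ : ∀ {p q p′ q′} → a₁ ≤ p → a₁ ≤ p′ →
    taxicab (p , q) (a₁ , a₂) ≡ taxicab (p′ , q′) (a₁ , a₂) →
    taxicab (p , q) (c₁ , a₂) ≡ taxicab (p′ , q′) (c₁ , a₂) → p ≡ p′ ⊎ (c₁ ≤ p × c₁ ≤ p′)
  codes-at-a,c⇒p≡p′⊎c₁≤p,p′ {p} {q} {p′} {q′} a₁≤p a₁≤p′ ea ec =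
    ∣m-a∣+∣n-k∣≡∣n-a∣+∣m-k∣⇒m≡n⊎k≤m×k≤n a₁≤p a₁≤p′
      (m+n≡m′+n′⇒o+n≡o′+n′⇒m+o′≡m′+o
        ∣ p - a₁ ∣ ∣ q - a₂ ∣ ∣ p - c₁ ∣ ∣ p′ - a₁ ∣ ∣ q′ - a₂ ∣ ∣ p′ - c₁ ∣ ea ec)

  resolves : b₁ ≤ c₁ → ∀ {s t} → Admissible s → Admissible t →
    taxicab s (a₁ , a₂) ≡ taxicab t (a₁ , a₂) →
    taxicab s (b₁ , b₂) ≡ taxicab t (b₁ , b₂) →
    taxicab s (c₁ , a₂) ≡ taxicab t (c₁ , a₂) → s ≡ t
  resolves b₁≤c₁ {p , q} {p′ , q′} (a₁≤p , q≤b₂ , far) (a₁≤p′ , q′≤b₂ , far′) ea eb ec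
    with codes-at-a,c⇒p≡p′⊎c₁≤p,p′ {q = q} {q′ = q′} a₁≤p a₁≤p′ ea ec
  ... | inj₁ refl = cong (p ,_) (∸-cancelˡ-≡ q≤b₂ q′≤b₂ (begin
          b₂ ∸ q       ≡⟨ m≤n⇒∣m-n∣≡n∸m q≤b₂ ⟨
          ∣ q - b₂ ∣   ≡⟨ +-cancelˡ-≡ ∣ p - b₁ ∣ _ _ eb ⟩
          ∣ q′ - b₂ ∣  ≡⟨ m≤n⇒∣m-n∣≡n∸m q′≤b₂ ⟩
          b₂ ∸ q′      ∎))
    where open ≡-Reasoning
  ... | inj₂ (c₁≤p , c₁≤p′) = cong₂ _,_ p≡p′ (+-cancelˡ-≡ p′ q q′ (trans (cong (_+ q) (sym p≡p′)) sum≡))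
    where
      sum≡ : p + q ≡ p′ + q′
      sum≡ = trans (sym (taxicab-≥ a₁≤p (far c₁≤p)))
                   (trans (cong (_+ (a₁ + a₂)) ea) (taxicab-≥ a₁≤p′ (far′ c₁≤p′)))
      skew≡ : p + (b₂ ∸ q) ≡ p′ + (b₂ ∸ q′)
      skew≡ = trans (sym (taxicab-≥≤ (≤-trans b₁≤c₁ c₁≤p) q≤b₂))
                    (trans (cong (_+ b₁) eb) (taxicab-≥≤ (≤-trans b₁≤c₁ c₁≤p′) q′≤b₂))
      p≡p′ : p ≡ p′
      p≡p′ = m+n≡m′+n′⇒m+o≡m′+o′⇒n+o≡n′+o′⇒m≡m′ sum≡ skew≡
        (trans (m+[n∸m]≡n q≤b₂) (sym (m+[n∸m]≡n q′≤b₂)))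

equidistant⇒taxicab≡ : ∀ {m n s t r} → 1 ≤ m → 1 ≤ n →
  InGrid m n s → InGrid m n t → InGrid m n r → ∃[ d ] (Dist m n s r d × Dist m n t r d) →
  taxicab (rotate (2 * m) s) (rotate (2 * m) r) ≡ taxicab (rotate (2 * m) t) (rotate (2 * m) r)
equidistant⇒taxicab≡ {m} {s = s@(x , _)} {t@(x′ , _)} {r@(a , _)} 1≤m 1≤n
  gs@(_ , y≤2m , _) gt@(_ , y′≤2m , _) gr@(_ , b≤2m , _) (d , ds , dt) = begin
    taxicab (rotate (2 * m) s) (rotate (2 * m) r)  ≡⟨ 2*cheb≡taxicab∘rotate (2 * m) {x} {x′ = a} y≤2m b≤2m ⟨
    2 * cheb s r                                   ≡⟨ cong (2 *_) (dist≡cheb 1≤m 1≤n gs gr ds) ⟨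
    2 * d                                          ≡⟨ cong (2 *_) (dist≡cheb 1≤m 1≤n gt gr dt) ⟩
    2 * cheb t r                                   ≡⟨ 2*cheb≡taxicab∘rotate (2 * m) {x′} {x′ = a} y′≤2m b≤2m ⟩
    taxicab (rotate (2 * m) t) (rotate (2 * m) r)  ∎
  where open ≡-Reasoning

2*[1+n]≡1+[2n+1] : ∀ n → 2 * suc n ≡ suc (2 * n + 1)
2*[1+n]≡1+[2n+1] = solve-∀

odd≤2[1+n]⇒≤2n+1 : ∀ {x n} → parity x ≡ 1ℙ → x ≤ 2 * suc n → x ≤ 2 * n + 1
odd≤2[1+n]⇒≤2n+1 {x} {n} x-odd x≤ = ≤-pred (subst (x <_) (2*[1+n]≡1+[2n+1] n) (≤∧≢⇒< x≤ x≢))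
  where
    x≢ : x ≢ 2 * suc n
    x≢ x≡ with () ← trans (sym x-odd) (trans (cong parity x≡) (parity-even (suc n)))

x+[c∸y]≤b+c : ∀ {b c x y} → x ≤ suc b → y ≤ c → (y ≡ 0 → x ≤ b) → x + (c ∸ y) ≤ b + c
x+[c∸y]≤b+c {c = c} {y = zero} _ _ x≤b = +-monoˡ-≤ c (x≤b refl)
x+[c∸y]≤b+c {b} {suc c} {x} {suc y} x≤1+b (s≤s y≤c) _ = begin
  x + (c ∸ y)  ≤⟨ +-mono-≤ x≤1+b (m∸n≤m c y) ⟩
  suc b + c    ≡⟨ +-suc b c ⟨
  b + suc c    ∎
  where open ≤-Reasoning

-- Landmarks for VG¹_{m, n + 1}.  Rotated by 2m they become (1, 1 + 2m), (2n + 1, 2n + 1 + 2m)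
-- and, after rotate-landmark₃, (1 + 2m + 2m, 1 + 2m).
module Landmarks (m n : ℕ) where

  open ThreeLandmarks 1 (1 + 2 * m) (2 * n + 1 + 0) (2 * n + 1 + 2 * m) (1 + 2 * m + 2 * m) public

  landmarks : List Pt
  landmarks = (1 , 0) ∷ (2 * n + 1 , 0) ∷ (2 * m + 1 , 2 * m) ∷ []

  landmarks-are-vertices : m < suc n → All (IsVertex m (suc n)) landmarks
  landmarks-are-vertices m<1+n =
    inj₂ (0 , 0 , s≤s z≤n , z≤n , refl , refl) ∷
    inj₂ (n , 0 , ≤-refl , z≤n , refl , refl) ∷
    inj₂ (m , m , m<1+n , ≤-refl , refl , refl) ∷ []

  rotate-landmark₃ : rotate (2 * m) (2 * m + 1 , 2 * m) ≡ (1 + 2 * m + 2 * m , 1 + 2 * m)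
  rotate-landmark₃ = cong₂ _,_ (cong (_+ 2 * m) (+-comm (2 * m) 1)) (begin
    2 * m + 1 + (2 * m ∸ 2 * m)  ≡⟨ cong (2 * m + 1 +_) (n∸n≡0 (2 * m)) ⟩
    2 * m + 1 + 0                ≡⟨ +-identityʳ _ ⟩
    2 * m + 1                    ≡⟨ +-comm (2 * m) 1 ⟩
    1 + 2 * m                    ∎)
    where open ≡-Reasoning

  b₁≤c₁ : suc n ≤ 2 * m + 1 → 2 * n + 1 + 0 ≤ 1 + 2 * m + 2 * m
  b₁≤c₁ 1+n≤2m+1 = begin
    2 * n + 1 + 0      ≡⟨ lhs n ⟩
    1 + 2 * n          ≤⟨ s≤s (*-monoʳ-≤ 2 n≤2m) ⟩
    1 + 2 * (2 * m)    ≡⟨ rhs m ⟩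
    1 + 2 * m + 2 * m  ∎
    where
      open ≤-Reasoning
      n≤2m : n ≤ 2 * m
      n≤2m = ≤-pred (subst (suc n ≤_) (+-comm (2 * m) 1) 1+n≤2m+1)
      lhs : ∀ n → 2 * n + 1 + 0 ≡ 1 + 2 * n
      lhs = solve-∀
      rhs : ∀ m → 1 + 2 * (2 * m) ≡ 1 + 2 * m + 2 * m
      rhs = solve-∀

  rotate-admissible : ∀ {x y} → InGrid m (suc n) (x , y) → Admissible (rotate (2 * m) (x , y))
  rotate-admissible {x} g@(x≤2+2n , y≤2m , opposite) =
    inGrid⇒0<x+y {m} {suc n} g ,
    x+[c∸y]≤b+c (subst (x ≤_) (2*[1+n]≡1+[2n+1] n) x≤2+2n) y≤2m
      (λ { refl → odd≤2[1+n]⇒≤2n+1 (trans (sym (⁻¹-involutive _)) (cong _⁻¹ (sym opposite))) x≤2+2n }) ,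
    λ far → ≤-trans (+-cancelʳ-≤ (2 * m) (1 + 2 * m) x (≤-trans far (+-monoʳ-≤ x y≤2m))) (m≤m+n x _)

lemma4 : (m n : ℕ) → 1 ≤ m → m ≤ n → 2 ≤ n → n ≤ 2 * m + 1 → m ≢ n →
    DimAtMost m n 3
lemma4 m (suc n) 1≤m m≤1+n _ 1+n≤2m+1 m≢1+n = landmarks , (vertices , resolving) , ≤-refl
  where
    open Landmarks m n

    vertices : All (IsVertex m (suc n)) landmarks
    vertices = landmarks-are-vertices (≤∧≢⇒< m≤1+n m≢1+n)

    resolving : ∀ s t → IsVertex m (suc n) s → IsVertex m (suc n) t →
      SameCode m (suc n) landmarks s t → s ≡ t
    resolving s@(_ , _) t@(_ , _) s∈G t∈G same-code
      with isVertex⇒inGrid s∈G | isVertex⇒inGrid t∈G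
    ... | gs@(_ , y≤2m , _) | gt@(_ , y′≤2m , _) =
      rotate-injective (2 * m) y≤2m y′≤2m (resolves (b₁≤c₁ 1+n≤2m+1)
        (rotate-admissible gs) (rotate-admissible gt) (code (here refl)) (code (there (here refl)))
        (subst (λ c → taxicab (rotate (2 * m) s) c ≡ taxicab (rotate (2 * m) t) c) rotate-landmark₃
          (code (there (there (here refl))))))
      where
        code : ∀ {r} → r ∈ landmarks →
          taxicab (rotate (2 * m) s) (rotate (2 * m) r) ≡ taxicab (rotate (2 * m) t) (rotate (2 * m) r)
        code r∈R = equidistant⇒taxicab≡ 1≤m (s≤s z≤n) gs gt
          (isVertex⇒inGrid (All.lookup vertices r∈R)) (same-code _ r∈R)
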